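{- Let $m\geq 2$ and $r\geq 2$ be integers, and let $\alpha_{m,r}(1),\ldots,\alpha_{m,r}(r)$ be the unique integers such that $\binom{mn+r-1}{r}=\sum_{i=1}^{r}\alpha_{m,r}(i)\binom{n+i-1}{i}$ for all integers $n$. Then for every $i\in\{1,\ldots,r\}$, \[ \mu(mi,r)\mid \alpha_{m,r}(i). \] In particular, $\mu(m,r)\mid\alpha_{m,r}(i)$ for all $i\in\{1,\ldots,r\}$.
   Context: For positive integers $a,b$, $\mu(a,b):=\frac{a}{\gcd(a,b)}$. -}

module Defs where

open import Data.Nat using (ℕ; zero; suc)
open import Data.Nat.Divisibility using (quotient)
open import Data.Nat.GCD using (gcd; gcd[m,n]∣m)
open import Data.Integer using (ℤ; 0ℤ; _+_)

μ : ℕ → ℕ → ℕ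
μ a b = quotient (gcd[m,n]∣m a b)

Σ₁ : ℕ → (ℕ → ℤ) → ℤ
Σ₁ zero    f = 0ℤ
Σ₁ (suc r) f = Σ₁ r f + f (suc r)

module Submission where

-- Put r = k+1, H_j(n) = C(n+j, j) and K_j(n) = C(n+j, j+1), so that the hypothesis reads
-- C(mn+k, r) = Σ_j α_{j+1} K_j(n). By finite differences C(mn+k, k) is an integral combination
-- Σ_j c_j H_j(n), and the absorption identity gives both r C(mn+k, r) = mn C(mn+k, k) and
-- n H_j(n) = (j+1) K_j(n). Hence Σ_j r α_{j+1} K_j(n) = Σ_j m (j+1) c_j K_j(n) for all n, and since
-- the K_j are linearly independent, r α_i = m i c_{i-1}. So m i divides r α_i, and μ(mi, r) divides α_i.

open import Defs
open import Data.Nat using (ℕ; _≤_; _∸_; suc)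
open import Data.Nat.Combinatorics using (_C_)
open import Data.Integer using (ℤ; +_; _*_)
open import Data.Integer.Divisibility using (_∣_)
open import Data.Product using (_×_)
open import Relation.Binary.PropositionalEquality using (_≡_)

open import Data.Nat as ℕ using (zero; _<_; z≤n; s≤s; NonZero; ≢-nonZero; ≢-nonZero⁻¹)
import Data.Nat.Properties as ℕₚ
import Data.Nat.Divisibility as ℕ∣
open import Data.Nat.Combinatorics
  using (nCk+nC[k+1]≡[n+1]C[k+1]; k>n⇒nCk≡0; nCn≡1; nCk≡nC[n∸k])
open import Data.Nat.GCD using (gcd; gcd[m,n]∣m; gcd[m,n]∣n; gcd[m,n]≢0)
open import Data.Nat.Coprimality using (Coprime; coprime-/gcd; coprime-divisor)
open import Data.Integer using (0ℤ; 1ℤ; -1ℤ; _+_; _-_; ∣_∣)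
import Data.Integer.Properties as ℤₚ
open import Data.Integer.Tactic.RingSolver using (solve-∀)
open import Algebra.Properties.AbelianGroup ℤₚ.+-0-abelianGroup using (∙-cancelˡ; ∙-cancelʳ; xyx⁻¹≈y)
open import Algebra.Properties.CommutativeSemigroup ℤₚ.+-commutativeSemigroup using (interchange)
open import Data.Empty using (⊥-elim)
open import Data.Product using (_,_)
open import Data.Sum using (inj₂)
open import Relation.Nullary using (yes; no)
open import Relation.Binary.PropositionalEquality
  using (_≢_; refl; sym; trans; cong; cong₂; subst; subst₂; module ≡-Reasoning)

open ≡-Reasoning

-- Binomial coefficients by Pascal's rule, so that they compute; C≡choose relates them to _C_.
infix 8 _choose_

_choose_ : ℕ → ℕ → ℕ
n     choose zero  = 1
zero  choose suc k = 0
suc n choose suc k = n choose k ℕ.+ n choose suc k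

C≡choose : ∀ n k → n C k ≡ n choose k
C≡choose n       zero    = trans (nCk≡nC[n∸k] {k = 0} {n = n} z≤n) (nCn≡1 n)
C≡choose zero    (suc k) = k>n⇒nCk≡0 {0} {suc k} (s≤s z≤n)
C≡choose (suc n) (suc k) =
  trans (sym (nCk+nC[k+1]≡[n+1]C[k+1] n k)) (cong₂ ℕ._+_ (C≡choose n k) (C≡choose n (suc k)))

k>n⇒choose≡0 : ∀ {n k} → n < k → n choose k ≡ 0
k>n⇒choose≡0 {zero}  {suc k} _         = refl
k>n⇒choose≡0 {suc n} {suc k} (s≤s n<k) =
  cong₂ ℕ._+_ (k>n⇒choose≡0 n<k) (k>n⇒choose≡0 (ℕₚ.m<n⇒m<1+n n<k))

choose-1 : ∀ n → n choose 1 ≡ n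
choose-1 zero    = refl
choose-1 (suc n) = cong suc (choose-1 n)

choose-absorb : ∀ a k → suc k ℕ.* (a ℕ.+ k) choose suc k ≡ a ℕ.* (a ℕ.+ k) choose k
choose-absorb a zero = begin
  1 ℕ.* (a ℕ.+ 0) choose 1  ≡⟨ ℕₚ.*-identityˡ _ ⟩
  (a ℕ.+ 0) choose 1         ≡⟨ choose-1 (a ℕ.+ 0) ⟩
  a ℕ.+ 0                    ≡⟨ ℕₚ.+-identityʳ a ⟩
  a                          ≡⟨ ℕₚ.*-identityʳ a ⟨
  a ℕ.* 1                    ∎
choose-absorb zero (suc k) =
  trans (cong (suc (suc k) ℕ.*_) (k>n⇒choose≡0 (ℕₚ.n<1+n (suc k)))) (ℕₚ.*-zeroʳ (suc (suc k)))
choose-absorb (suc a) (suc k) = begin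
  suc (suc k) ℕ.* (X ℕ.+ Y)                 ≡⟨ ℕₚ.*-distribˡ-+ (suc (suc k)) X Y ⟩
  suc (suc k) ℕ.* X ℕ.+ suc (suc k) ℕ.* Y   ≡⟨ cong (suc (suc k) ℕ.* X ℕ.+_) (choose-absorb a (suc k)) ⟩
  suc (suc k) ℕ.* X ℕ.+ a ℕ.* X             ≡⟨ ℕₚ.*-distribʳ-+ X (suc (suc k)) a ⟨
  (suc (suc k) ℕ.+ a) ℕ.* X                 ≡⟨ cong (ℕ._* X) (ℕₚ.+-suc (suc k) a) ⟨
  (suc k ℕ.+ suc a) ℕ.* X                   ≡⟨ ℕₚ.*-distribʳ-+ X (suc k) (suc a) ⟩
  suc k ℕ.* X ℕ.+ suc a ℕ.* X               ≡⟨ cong (ℕ._+ suc a ℕ.* X) absorb-k ⟩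
  suc a ℕ.* Z ℕ.+ suc a ℕ.* X               ≡⟨ ℕₚ.*-distribˡ-+ (suc a) Z X ⟨
  suc a ℕ.* (Z ℕ.+ X)                       ∎
  where
  X = (a ℕ.+ suc k) choose suc k
  Y = (a ℕ.+ suc k) choose suc (suc k)
  Z = (a ℕ.+ suc k) choose k
  absorb-k : suc k ℕ.* X ≡ suc a ℕ.* Z
  absorb-k = subst (λ t → suc k ℕ.* t choose suc k ≡ suc a ℕ.* t choose k)
                   (sym (ℕₚ.+-suc a k)) (choose-absorb (suc a) k)

pred-C≡choose : ∀ x i → (x ℕ.+ suc i ∸ 1) C suc i ≡ (x ℕ.+ i) choose suc i
pred-C≡choose x i = trans (cong (λ t → (t ∸ 1) C suc i) (ℕₚ.+-suc x i)) (C≡choose (x ℕ.+ i) (suc i))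

∑< : ℕ → (ℕ → ℤ) → ℤ
∑< zero    f = 0ℤ
∑< (suc d) f = ∑< d f + f d

Σ₁≡∑< : ∀ r f → Σ₁ r f ≡ ∑< r (λ i → f (suc i))
Σ₁≡∑< zero    f = refl
Σ₁≡∑< (suc r) f = cong (_+ f (suc r)) (Σ₁≡∑< r f)

∑<-cong : ∀ d {f g : ℕ → ℤ} → (∀ j → j < d → f j ≡ g j) → ∑< d f ≡ ∑< d g
∑<-cong zero    f≡g = refl
∑<-cong (suc d) f≡g = cong₂ _+_ (∑<-cong d (λ j j<d → f≡g j (ℕₚ.m<n⇒m<1+n j<d))) (f≡g d ℕₚ.≤-refl)

∑<-0 : ∀ d {f : ℕ → ℤ} → (∀ j → j < d → f j ≡ 0ℤ) → ∑< d f ≡ 0ℤ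
∑<-0 zero    f≡0 = refl
∑<-0 (suc d) f≡0 = cong₂ _+_ (∑<-0 d (λ j j<d → f≡0 j (ℕₚ.m<n⇒m<1+n j<d))) (f≡0 d ℕₚ.≤-refl)

∑<-distrib-+ : ∀ d (f g : ℕ → ℤ) → ∑< d (λ j → f j + g j) ≡ ∑< d f + ∑< d g
∑<-distrib-+ zero    f g = refl
∑<-distrib-+ (suc d) f g =
  trans (cong (_+ (f d + g d)) (∑<-distrib-+ d f g)) (interchange (∑< d f) (∑< d g) (f d) (g d))

*-distribˡ-∑< : ∀ d x (f : ℕ → ℤ) → x * ∑< d f ≡ ∑< d (λ j → x * f j)
*-distribˡ-∑< zero    x f = ℤₚ.*-zeroʳ x
*-distribˡ-∑< (suc d) x f =
  trans (ℤₚ.*-distribˡ-+ x (∑< d f) (f d)) (cong (_+ x * f d) (*-distribˡ-∑< d x f))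

∑<-head : ∀ d (f : ℕ → ℤ) → ∑< (suc d) f ≡ f 0 + ∑< d (λ j → f (suc j))
∑<-head zero    f = ℤₚ.+-comm 0ℤ (f 0)
∑<-head (suc d) f = trans (cong (_+ f (suc d)) (∑<-head d f)) (ℤₚ.+-assoc (f 0) _ _)

δ : ℕ → ℕ → ℤ
δ i j with i ℕ.≟ j
... | yes _ = 1ℤ
... | no  _ = 0ℤ

δ≢ : ∀ {i j} → i ≢ j → δ i j ≡ 0ℤ
δ≢ {i} {j} i≢j with i ℕ.≟ j
... | yes i≡j = ⊥-elim (i≢j i≡j)
... | no  _   = refl

∑<-δ : ∀ d {i} (f : ℕ → ℤ) → i < d → ∑< d (λ j → δ i j * f j) ≡ f i
∑<-δ (suc d) {i} f i<1+d with i ℕ.≟ d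
... | yes refl = begin
  ∑< i (λ j → δ i j * f j) + 1ℤ * f i  ≡⟨ cong₂ _+_ off-diagonal (ℤₚ.*-identityˡ (f i)) ⟩
  0ℤ + f i                             ≡⟨ ℤₚ.+-identityˡ (f i) ⟩
  f i                                  ∎
  where
  off-diagonal : ∑< i (λ j → δ i j * f j) ≡ 0ℤ
  off-diagonal = ∑<-0 i (λ j j<i → cong (_* f j) (δ≢ (ℕₚ.>⇒≢ j<i)))
... | no i≢d = trans (cong₂ _+_ (∑<-δ d f (ℕₚ.≤∧≢⇒< (ℕₚ.≤-pred i<1+d) i≢d)) (ℤₚ.*-zeroˡ (f d)))
                     (ℤₚ.+-identityʳ (f i))

lincomb : ℕ → (ℕ → ℤ) → (ℕ → ℕ → ℤ) → ℕ → ℤ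
lincomb d c b n = ∑< d (λ j → c j * b j n)

*-distribˡ-lincomb : ∀ d x c (b : ℕ → ℕ → ℤ) n → x * lincomb d c b n ≡ lincomb d (λ j → x * c j) b n
*-distribˡ-lincomb d x c b n =
  trans (*-distribˡ-∑< d x _) (∑<-cong d (λ j _ → sym (ℤₚ.*-assoc x (c j) (b j n))))

H K : ℕ → ℕ → ℤ
H j n = + ((n ℕ.+ j) choose j)
K j n = + ((n ℕ.+ j) choose suc j)

K-zero : ∀ j → K j 0 ≡ 0ℤ
K-zero j = cong +_ (k>n⇒choose≡0 (ℕₚ.n<1+n j))

K-suc : ∀ j n → K j (suc n) ≡ H j n + K j n
K-suc j n = refl

H-suc≡K-suc : ∀ j n → H (suc j) n ≡ K j (suc n)
H-suc≡K-suc j n = cong (λ t → + (t choose suc j)) (ℕₚ.+-suc n j)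

H-step : ∀ j n → H (suc j) (suc n) ≡ H (suc j) n + H j (suc n)
H-step j n = begin
  H (suc j) (suc n)          ≡⟨ H-suc≡K-suc j (suc n) ⟩
  H j (suc n) + K j (suc n)  ≡⟨ ℤₚ.+-comm (H j (suc n)) (K j (suc n)) ⟩
  K j (suc n) + H j (suc n)  ≡⟨ cong (_+ H j (suc n)) (H-suc≡K-suc j n) ⟨
  H (suc j) n + H j (suc n)  ∎

H-absorb : ∀ j n → + n * H j n ≡ + suc j * K j n
H-absorb j n = begin
  + n * H j n                                ≡⟨ ℤₚ.pos-* n _ ⟨
  + (n ℕ.* (n ℕ.+ j) choose j)               ≡⟨ cong +_ (choose-absorb n j) ⟨
  + (suc j ℕ.* (n ℕ.+ j) choose suc j)       ≡⟨ ℤₚ.pos-* (suc j) _ ⟩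
  + suc j * K j n                            ∎

record Span (d : ℕ) (φ : ℕ → ℤ) : Set where
  constructor span
  field
    coefficient : ℕ → ℤ
    expansion   : ∀ n → φ n ≡ lincomb (suc d) coefficient H n

module _ {d : ℕ} where

  span-cong : ∀ {φ ψ} → (∀ n → φ n ≡ ψ n) → Span d φ → Span d ψ
  span-cong φ≡ψ (span c φ≡) = span c λ n → trans (sym (φ≡ψ n)) (φ≡ n)

  span-+ : ∀ {φ ψ} → Span d φ → Span d ψ → Span d (λ n → φ n + ψ n)
  span-+ {φ} {ψ} (span c φ≡) (span c′ ψ≡) = span (λ j → c j + c′ j) λ n → begin
    φ n + ψ n                                ≡⟨ cong₂ _+_ (φ≡ n) (ψ≡ n) ⟩
    lincomb (suc d) c H n + lincomb (suc d) c′ H n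
      ≡⟨ ∑<-distrib-+ (suc d) _ _ ⟨
    ∑< (suc d) (λ j → c j * H j n + c′ j * H j n)
      ≡⟨ ∑<-cong (suc d) (λ j _ → ℤₚ.*-distribʳ-+ (H j n) (c j) (c′ j)) ⟨
    lincomb (suc d) (λ j → c j + c′ j) H n  ∎

  span-* : ∀ {φ} x → Span d φ → Span d (λ n → x * φ n)
  span-* x (span c φ≡) = span (λ j → x * c j) λ n →
    trans (cong (x *_) (φ≡ n)) (*-distribˡ-lincomb (suc d) x c H n)

  span-- : ∀ {φ ψ} → Span d φ → Span d ψ → Span d (λ n → φ n - ψ n)
  span-- {φ} {ψ} sφ sψ =
    span-cong (λ n → cong (_+_ (φ n)) (ℤₚ.-1*i≡-i (ψ n))) (span-+ sφ (span-* -1ℤ sψ))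

  span-H : ∀ {i} → i ≤ d → Span d (H i)
  span-H {i} i≤d = span (δ i) λ n → sym (∑<-δ (suc d) (λ j → H j n) (s≤s i≤d))

  span-const : ∀ x → Span d (λ _ → x)
  span-const x = span-cong (λ _ → ℤₚ.*-identityʳ x) (span-* x (span-H z≤n))

  span-∑ : ∀ s (F : ℕ → ℕ → ℤ) → (∀ t → t < s → Span d (F t)) → Span d (λ n → ∑< s (λ t → F t n))
  span-∑ zero    F sF = span-const 0ℤ
  span-∑ (suc s) F sF = span-+ (span-∑ s F (λ t t<s → sF t (ℕₚ.m<n⇒m<1+n t<s))) (sF s ℕₚ.≤-refl)

span-K : ∀ {d j} → j ≤ d → Span (suc d) (K j)
span-K {d} {j} j≤d = span-cong K≡ (span-- (span-H (s≤s j≤d)) (span-H (ℕₚ.m≤n⇒m≤1+n j≤d)))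
  where
  K≡ : ∀ n → H (suc j) n - H j n ≡ K j n
  K≡ n = trans (cong (_- H j n) (trans (H-suc≡K-suc j n) (K-suc j n))) (xyx⁻¹≈y (H j n) (K j n))

-- φ(n) = φ(0) + Σ b_j K_j(n) whenever ψ = Σ b_j H_j, since K_j(0) = 0 and ΔK_j = H_j
span-Δ : ∀ {d φ ψ} → Span d ψ → (∀ n → φ (suc n) ≡ φ n + ψ n) → Span (suc d) φ
span-Δ {d} {φ} {ψ} (span b ψ≡) φ-suc =
  span-cong (λ n → sym (φ≡ n))
    (span-+ (span-const (φ 0))
      (span-∑ (suc d) (λ j n → b j * K j n) (λ j j<1+d → span-* (b j) (span-K (ℕₚ.≤-pred j<1+d)))))
  where
  φ≡ : ∀ n → φ n ≡ φ 0 + lincomb (suc d) b K n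
  φ≡ zero = sym (trans (cong (_+_ (φ 0)) (∑<-0 (suc d) b*K-zero)) (ℤₚ.+-identityʳ (φ 0)))
    where
    b*K-zero : ∀ j → j < suc d → b j * K j 0 ≡ 0ℤ
    b*K-zero j _ = trans (cong (b j *_) (K-zero j)) (ℤₚ.*-zeroʳ (b j))
  φ≡ (suc n) = begin
    φ (suc n)                                               ≡⟨ φ-suc n ⟩
    φ n + ψ n                                               ≡⟨ cong₂ _+_ (φ≡ n) (ψ≡ n) ⟩
    φ 0 + lincomb (suc d) b K n + lincomb (suc d) b H n     ≡⟨ ℤₚ.+-assoc (φ 0) _ _ ⟩
    φ 0 + (lincomb (suc d) b K n + lincomb (suc d) b H n)
      ≡⟨ cong (_+_ (φ 0)) (ℤₚ.+-comm (lincomb (suc d) b K n) (lincomb (suc d) b H n)) ⟩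
    φ 0 + (lincomb (suc d) b H n + lincomb (suc d) b K n)   ≡⟨ cong (_+_ (φ 0)) (∑<-distrib-+ (suc d) _ _) ⟨
    φ 0 + ∑< (suc d) (λ j → b j * H j n + b j * K j n)
      ≡⟨ cong (_+_ (φ 0)) (∑<-cong (suc d) (λ j _ → ℤₚ.*-distribˡ-+ (b j) (H j n) (K j n))) ⟨
    φ 0 + lincomb (suc d) b K (suc n)                       ∎

hockey-stick : ∀ d N s → + ((N ℕ.+ s) choose suc d) ≡ + (N choose suc d) + ∑< s (λ t → + ((N ℕ.+ t) choose d))
hockey-stick d N zero    = trans (cong (λ t → + (t choose suc d)) (ℕₚ.+-identityʳ N)) (sym (ℤₚ.+-identityʳ _))
hockey-stick d N (suc s) = begin
  + ((N ℕ.+ suc s) choose suc d)  ≡⟨ cong (λ t → + (t choose suc d)) (ℕₚ.+-suc N s) ⟩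
  A + B                           ≡⟨ ℤₚ.+-comm A B ⟩
  B + A                           ≡⟨ cong (_+ A) (hockey-stick d N s) ⟩
  + (N choose suc d) + S + A      ≡⟨ ℤₚ.+-assoc (+ (N choose suc d)) S A ⟩
  + (N choose suc d) + (S + A)    ∎
  where
  A = + ((N ℕ.+ s) choose d)
  B = + ((N ℕ.+ s) choose suc d)
  S = ∑< s (λ t → + ((N ℕ.+ t) choose d))

span-choose : ∀ m d k → Span d (λ n → + ((m ℕ.* n ℕ.+ k) choose d))
span-choose m zero    k = span-const 1ℤ
span-choose m (suc d) k =
  span-Δ (span-∑ m (λ t n → + ((m ℕ.* n ℕ.+ (k ℕ.+ t)) choose d)) (λ t _ → span-choose m d (k ℕ.+ t))) step
  where
  step : ∀ n → + ((m ℕ.* suc n ℕ.+ k) choose suc d)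
             ≡ + ((m ℕ.* n ℕ.+ k) choose suc d) + ∑< m (λ t → + ((m ℕ.* n ℕ.+ (k ℕ.+ t)) choose d))
  step n = begin
    + ((m ℕ.* suc n ℕ.+ k) choose suc d)
      ≡⟨ cong (λ t → + (t choose suc d)) m[1+n]+k≡mn+k+m ⟩
    + ((m ℕ.* n ℕ.+ k ℕ.+ m) choose suc d)
      ≡⟨ hockey-stick d (m ℕ.* n ℕ.+ k) m ⟩
    + ((m ℕ.* n ℕ.+ k) choose suc d) + ∑< m (λ t → + ((m ℕ.* n ℕ.+ k ℕ.+ t) choose d))
      ≡⟨ cong (_+_ (+ ((m ℕ.* n ℕ.+ k) choose suc d)))
              (∑<-cong m (λ t _ → cong (λ x → + (x choose d)) (ℕₚ.+-assoc (m ℕ.* n) k t))) ⟩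
    + ((m ℕ.* n ℕ.+ k) choose suc d) + ∑< m (λ t → + ((m ℕ.* n ℕ.+ (k ℕ.+ t)) choose d))  ∎
    where
    m[1+n]+k≡mn+k+m : m ℕ.* suc n ℕ.+ k ≡ m ℕ.* n ℕ.+ k ℕ.+ m
    m[1+n]+k≡mn+k+m = trans (cong (ℕ._+ k) (ℕₚ.*-suc m n))
                            (trans (ℕₚ.+-assoc m (m ℕ.* n) k) (ℕₚ.+-comm m (m ℕ.* n ℕ.+ k)))

lincomb-H-head : ∀ d a x → lincomb (suc d) a H x ≡ a 0 + lincomb d (λ j → a (suc j)) (λ j → H (suc j)) x
lincomb-H-head d a x =
  trans (∑<-head d (λ j → a j * H j x))
        (cong (_+ lincomb d (λ j → a (suc j)) (λ j → H (suc j)) x) (ℤₚ.*-identityʳ (a 0)))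

lincomb-H-suc : ∀ d a x →
  lincomb (suc d) a H (suc x) ≡ lincomb (suc d) a H x + lincomb d (λ j → a (suc j)) H (suc x)
lincomb-H-suc d a x = begin
  lincomb (suc d) a H (suc x)
    ≡⟨ lincomb-H-head d a (suc x) ⟩
  a 0 + ∑< d (λ j → a (suc j) * H (suc j) (suc x))
    ≡⟨ cong (_+_ (a 0)) (∑<-cong d (λ j _ → cong (a (suc j) *_) (H-step j x))) ⟩
  a 0 + ∑< d (λ j → a (suc j) * (H (suc j) x + H j (suc x)))
    ≡⟨ cong (_+_ (a 0)) (∑<-cong d (λ j _ → ℤₚ.*-distribˡ-+ (a (suc j)) (H (suc j) x) (H j (suc x)))) ⟩
  a 0 + ∑< d (λ j → a (suc j) * H (suc j) x + a (suc j) * H j (suc x))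
    ≡⟨ cong (_+_ (a 0)) (∑<-distrib-+ d _ _) ⟩
  a 0 + (T + U)
    ≡⟨ ℤₚ.+-assoc (a 0) T U ⟨
  a 0 + T + U
    ≡⟨ cong (_+ U) (lincomb-H-head d a x) ⟨
  lincomb (suc d) a H x + U
    ∎
  where
  T = lincomb d (λ j → a (suc j)) (λ j → H (suc j)) x
  U = lincomb d (λ j → a (suc j)) H (suc x)

head-coefficient : ∀ d {a b x} → lincomb (suc d) a H x ≡ lincomb (suc d) b H x →
  (∀ j → j < d → a (suc j) ≡ b (suc j)) → a 0 ≡ b 0
head-coefficient d {a} {b} {x} a≡b tails≡ = ∙-cancelʳ (tail a) (a 0) (b 0) (begin
  a 0 + tail a             ≡⟨ lincomb-H-head d a x ⟨
  lincomb (suc d) a H x    ≡⟨ a≡b ⟩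
  lincomb (suc d) b H x    ≡⟨ lincomb-H-head d b x ⟩
  b 0 + tail b             ≡⟨ cong (_+_ (b 0)) (∑<-cong d (λ j j<d → cong (_* H (suc j) x) (tails≡ j j<d))) ⟨
  b 0 + tail a             ∎)
  where
  tail : (ℕ → ℤ) → ℤ
  tail c = lincomb d (λ j → c (suc j)) (λ j → H (suc j)) x

-- The offset s is needed because differencing a combination of H's shifts the argument by one.
H-lincomb-injective : ∀ d s {a b : ℕ → ℤ} →
  (∀ n → lincomb (suc d) a H (s ℕ.+ n) ≡ lincomb (suc d) b H (s ℕ.+ n)) → ∀ j → j ≤ d → a j ≡ b j
H-lincomb-injective zero    s {a} {b} a≡b zero z≤n = head-coefficient zero {a} {b} {s ℕ.+ 0} (a≡b 0) (λ _ ())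
H-lincomb-injective (suc d) s {a} {b} a≡b = λ where
    zero    _         → head-coefficient (suc d) {a} {b} {s ℕ.+ 0} (a≡b 0) (λ j j<1+d → tails≡ j (ℕₚ.≤-pred j<1+d))
    (suc j) (s≤s j≤d) → tails≡ j j≤d
  where
  L T : (ℕ → ℤ) → ℕ → ℤ
  L c x = lincomb (suc (suc d)) c H x
  T c x = lincomb (suc d) (λ j → c (suc j)) H (suc x)
  differences≡ : ∀ n → T a (s ℕ.+ n) ≡ T b (s ℕ.+ n)
  differences≡ n = ∙-cancelˡ (L b N) (T a N) (T b N) (begin
    L b N + T a N  ≡⟨ cong (_+ T a N) (a≡b n) ⟨
    L a N + T a N  ≡⟨ lincomb-H-suc (suc d) a N ⟨
    L a (suc N)    ≡⟨ subst (λ x → L a x ≡ L b x) (ℕₚ.+-suc s n) (a≡b (suc n)) ⟩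
    L b (suc N)    ≡⟨ lincomb-H-suc (suc d) b N ⟩
    L b N + T b N  ∎)
    where N = s ℕ.+ n
  tails≡ : ∀ j → j ≤ d → a (suc j) ≡ b (suc j)
  tails≡ = H-lincomb-injective d (suc s) differences≡

K-lincomb-injective : ∀ d {a b : ℕ → ℤ} → (∀ n → lincomb d a K n ≡ lincomb d b K n) → ∀ j → j < d → a j ≡ b j
K-lincomb-injective d {a} {b} a≡b j = H-lincomb-injective d 0 {pad a} {pad b} padded≡ (suc j)
  where
  pad : (ℕ → ℤ) → ℕ → ℤ
  pad c zero    = 0ℤ
  pad c (suc j) = c j
  pad-H≡K : ∀ c n → lincomb (suc d) (pad c) H n ≡ lincomb d c K (suc n)
  pad-H≡K c n = begin
    lincomb (suc d) (pad c) H n               ≡⟨ lincomb-H-head d (pad c) n ⟩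
    0ℤ + lincomb d c (λ j → H (suc j)) n      ≡⟨ ℤₚ.+-identityˡ _ ⟩
    lincomb d c (λ j → H (suc j)) n           ≡⟨ ∑<-cong d (λ j _ → cong (c j *_) (H-suc≡K-suc j n)) ⟩
    lincomb d c K (suc n)                     ∎
  padded≡ : ∀ n → lincomb (suc d) (pad a) H n ≡ lincomb (suc d) (pad b) H n
  padded≡ n = trans (pad-H≡K a n) (trans (a≡b (suc n)) (sym (pad-H≡K b n)))

μ∣ : ∀ a r {x} .{{_ : NonZero r}} → + a ∣ + r * x → + μ a r ∣ x
μ∣ a r {x} a∣rx = coprime-divisor μ⊥ρ (ℕ∣.*-cancelˡ-∣ g gμ∣gρx)
  where
  g = gcd a r
  instance
    g≢0 : NonZero g
    g≢0 = ≢-nonZero (gcd[m,n]≢0 a r (inj₂ (≢-nonZero⁻¹ r)))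
  g∣a = gcd[m,n]∣m a r
  g∣r = gcd[m,n]∣n a r
  ρ = ℕ∣.quotient g∣r
  μ⊥ρ : Coprime (μ a r) ρ
  μ⊥ρ = subst₂ Coprime (ℕ∣.n/m≡quotient g∣a) (ℕ∣.n/m≡quotient g∣r) (coprime-/gcd a r)
  gμ∣gρx : g ℕ.* μ a r ℕ∣.∣ g ℕ.* (ρ ℕ.* ∣ x ∣)
  gμ∣gρx = subst₂ ℕ∣._∣_ (ℕ∣.m∣n⇒n≡m*quotient g∣a)
             (trans (cong (ℕ._* ∣ x ∣) (ℕ∣.m∣n⇒n≡m*quotient g∣r)) (ℕₚ.*-assoc g ρ ∣ x ∣))
             (subst (a ℕ∣.∣_) (ℤₚ.abs-* (+ r) x) a∣rx)

m[1+j]∣[1+k]α : ∀ m k (α : ℕ → ℤ) → (∀ n → K k (m ℕ.* n) ≡ lincomb (suc k) α K n) →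
  ∀ j → j ≤ k → + (m ℕ.* suc j) ∣ + suc k * α j
m[1+j]∣[1+k]α m k α K∘m≡ j j≤k =
  subst (+ (m ℕ.* suc j) ∣_) (sym (coefficients≡ j (s≤s j≤k))) (m∣m*x (m ℕ.* suc j) (c j))
  where
  open Span (span-choose m k k) renaming (coefficient to c; expansion to H∘m≡)
  m∣m*x : ∀ a x → + a ∣ + a * x
  m∣m*x a x = subst (a ℕ∣.∣_) (sym (ℤₚ.abs-* (+ a) x)) (ℕ∣.m∣m*n ∣ x ∣)
  term≡ : ∀ i n → + (m ℕ.* n) * (c i * H i n) ≡ + (m ℕ.* suc i) * c i * K i n
  term≡ i n = begin
    + (m ℕ.* n) * (c i * H i n)     ≡⟨ cong (_* (c i * H i n)) (ℤₚ.pos-* m n) ⟩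
    + m * + n * (c i * H i n)       ≡⟨ regroup (+ m) (+ n) (c i) (H i n) ⟩
    + m * c i * (+ n * H i n)       ≡⟨ cong (+ m * c i *_) (H-absorb i n) ⟩
    + m * c i * (+ suc i * K i n)   ≡⟨ regroup′ (+ m) (c i) (+ suc i) (K i n) ⟩
    + m * + suc i * c i * K i n     ≡⟨ cong (λ y → y * c i * K i n) (ℤₚ.pos-* m (suc i)) ⟨
    + (m ℕ.* suc i) * c i * K i n   ∎
    where
    regroup : ∀ w x y z → w * x * (y * z) ≡ w * y * (x * z)
    regroup = solve-∀
    regroup′ : ∀ w x y z → w * x * (y * z) ≡ w * y * x * z
    regroup′ = solve-∀
  combinations≡ : ∀ n → lincomb (suc k) (λ i → + suc k * α i) K n ≡ lincomb (suc k) (λ i → + (m ℕ.* suc i) * c i) K n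
  combinations≡ n = begin
    lincomb (suc k) (λ i → + suc k * α i) K n       ≡⟨ *-distribˡ-lincomb (suc k) (+ suc k) α K n ⟨
    + suc k * lincomb (suc k) α K n                 ≡⟨ cong (+ suc k *_) (K∘m≡ n) ⟨
    + suc k * K k (m ℕ.* n)                         ≡⟨ H-absorb k (m ℕ.* n) ⟨
    + (m ℕ.* n) * H k (m ℕ.* n)                     ≡⟨ cong (+ (m ℕ.* n) *_) (H∘m≡ n) ⟩
    + (m ℕ.* n) * lincomb (suc k) c H n             ≡⟨ *-distribˡ-∑< (suc k) (+ (m ℕ.* n)) _ ⟩
    ∑< (suc k) (λ i → + (m ℕ.* n) * (c i * H i n))  ≡⟨ ∑<-cong (suc k) (λ i _ → term≡ i n) ⟩
    lincomb (suc k) (λ i → + (m ℕ.* suc i) * c i) K n  ∎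
  coefficients≡ : ∀ i → i < suc k → + suc k * α i ≡ + (m ℕ.* suc i) * c i
  coefficients≡ = K-lincomb-injective (suc k) combinations≡

lemma2p5 : (m r : ℕ) → 2 ≤ m → 2 ≤ r → (α : ℕ → ℤ) →
    (∀ (n : ℕ) → + ((m Data.Nat.* n Data.Nat.+ r ∸ 1) C r)
    ≡ Σ₁ r (λ i → α i * + ((n Data.Nat.+ i ∸ 1) C i))) →
    (∀ (i : ℕ) → 1 ≤ i → i ≤ r → (+ μ (m Data.Nat.* i) r ∣ α i) × (+ μ m r ∣ α i))
lemma2p5 m (suc k) _ _ α hyp (suc j) _ (s≤s j≤k) =
  μ∣ (m ℕ.* suc j) (suc k) {α (suc j)} mi∣rα , μ∣ m (suc k) {α (suc j)} (ℕ∣.∣-trans (ℕ∣.m∣m*n (suc j)) mi∣rα)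
  where
  K∘m≡ : ∀ n → K k (m ℕ.* n) ≡ lincomb (suc k) (λ i → α (suc i)) K n
  K∘m≡ n = begin
    K k (m ℕ.* n)                                          ≡⟨ cong +_ (pred-C≡choose (m ℕ.* n) k) ⟨
    + ((m ℕ.* n ℕ.+ suc k ∸ 1) C suc k)                    ≡⟨ hyp n ⟩
    Σ₁ (suc k) (λ i → α i * + ((n ℕ.+ i ∸ 1) C i))          ≡⟨ Σ₁≡∑< (suc k) _ ⟩
    ∑< (suc k) (λ i → α (suc i) * + ((n ℕ.+ suc i ∸ 1) C suc i))
      ≡⟨ ∑<-cong (suc k) (λ i _ → cong (λ y → α (suc i) * + y) (pred-C≡choose n i)) ⟩
    lincomb (suc k) (λ i → α (suc i)) K n                  ∎
  mi∣rα : + (m ℕ.* suc j) ∣ + suc k * α (suc j)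
  mi∣rα = m[1+j]∣[1+k]α m k (λ i → α (suc i)) K∘m≡ j j≤k
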